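{- For every $\gamma>0$ there exists $n_0$ such that the following holds for all $n\ge n_0$: if $G$ is a $C_5$-free graph on $n$ vertices with minimum degree $\delta(G)\ge n/6+\gamma n$, then $G$ is triangle-free.
   Context: $C_5$ is the cycle of length 5; $C_5$-free means containing no 5-cycle as a subgraph; triangle-free means containing no 3-cycle.
   Formalization: The parameter γ ranges over the positive rationals only. -}

module Defs where

open import Data.Nat using (ℕ; suc)
open import Data.Bool using (Bool; true; false)
open import Data.Fin using (Fin)
open import Data.List using (List; filterᵇ; length)
open import Data.List using () renaming (allFin to allFinL)
open import Data.Fin.Base using ()
open import Data.Product using (_×_; ∃-syntax)
open import Data.Empty using (⊥)
open import Relation.Nullary using (¬_)
open import Relation.Binary.PropositionalEquality using (_≡_; _≢_)
open import Data.Integer using (+_)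
open import Data.Rational using (ℚ; _/_)

record Graph (n : ℕ) : Set where
  field
    adj   : Fin n → Fin n → Bool
    sym   : ∀ u v → adj u v ≡ adj v u
    irref : ∀ v → adj v v ≡ false

open Graph public

Adj : ∀ {n} → Graph n → Fin n → Fin n → Set
Adj G u v = adj G u v ≡ true

degree : ∀ {n} → Graph n → Fin n → ℕ
degree {n} G v = length (filterᵇ (adj G v) (allFinL n))

ℕ→ℚ : ℕ → ℚ
ℕ→ℚ k = + k / 1

HasTriangle : ∀ {n} → Graph n → Set
HasTriangle {n} G = ∃[ a ] ∃[ b ] ∃[ c ]
  ((a ≢ b) × (b ≢ c) × (a ≢ c) × Adj G a b × Adj G b c × Adj G a c)

TriangleFree : ∀ {n} → Graph n → Set
TriangleFree G = ¬ HasTriangle G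

HasC5 : ∀ {n} → Graph n → Set
HasC5 {n} G = ∃[ v₀ ] ∃[ v₁ ] ∃[ v₂ ] ∃[ v₃ ] ∃[ v₄ ]
  ( (v₀ ≢ v₁) × (v₀ ≢ v₂) × (v₀ ≢ v₃) × (v₀ ≢ v₄)
  × (v₁ ≢ v₂) × (v₁ ≢ v₃) × (v₁ ≢ v₄)
  × (v₂ ≢ v₃) × (v₂ ≢ v₄)
  × (v₃ ≢ v₄)
  × Adj G v₀ v₁ × Adj G v₁ v₂ × Adj G v₂ v₃ × Adj G v₃ v₄ × Adj G v₄ v₀ )

C5Free : ∀ {n} → Graph n → Set
C5Free G = ¬ HasC5 G

-- For any vertices u₁, …, uₖ, counting each vertex w by the number of uᵢ adjacent to it gives
-- Bonferroni's inequality  Σᵢ deg uᵢ ≤ n + Σ_{i<j} codeg(uᵢ, uⱼ).  If 6 δ(G) ≥ n + 49, then for any six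
-- vertices the codegrees of the fifteen pairs therefore sum to more than 48.  In a C₅-free graph two
-- vertices joined by a path of length 3 have codegree at most 2, since a third common neighbour closes a
-- 5-cycle.  So an edge has codegree at most 5 (six of its common neighbours would pairwise have codegree
-- at most 2, in total at most 30), and a triangle xyz together with further neighbours a, b, c of x, y, z
-- (all six distinct, which degree ≥ 5 allows) has codegree sum at most 6·5 + 9·2 = 48: the six edges xy,
-- xz, yz, xa, yb, zc of this spider contribute at most 5 each and every other pair is joined by a path of
-- length 3.  Finally, n/6 + γn ≤ δ(G) implies 6 δ(G) ≥ n + 54 once γn ≥ 9.

module Submission where

open import Defs renaming (sym to adj-sym)
open import Data.Fin using (Fin)
open import Data.Product using (_×_; _,_; proj₁; proj₂; ∃-syntax; uncurry)
open import Relation.Binary.PropositionalEquality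

module Combinatorics where

  open import Data.Bool using (Bool; true; false; _∧_)
  open import Data.Bool.Properties using (T-≡; T-∧; T?)
  open import Data.Fin.Properties using (_≟_)
  open import Data.List using (List; []; _∷_; _++_; map; length; filterᵇ; allFin; take)
  open import Data.List.Properties using (length-tabulate; length-take; length-map; length-++)
  open import Data.List.Membership.Propositional using (_∈_; find)
  open import Data.List.Membership.Propositional.Properties using (∈-∃++; ∈-filter⁻)
  open import Data.List.Relation.Binary.Permutation.Propositional.Properties using (shift; ∈-resp-↭; ↭-length)
  open import Data.List.Relation.Binary.Pointwise using (Pointwise; []; _∷_)
  open import Data.List.Relation.Binary.Subset.Propositional using (_⊆_)
  open import Data.List.Relation.Unary.All as All using (All; []; _∷_)
  open import Data.List.Relation.Unary.All.Properties using (¬All⇒Any¬; ¬Any⇒All¬; ++⁺; map⁺; take⁺)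
  open import Data.List.Relation.Unary.AllPairs using (AllPairs; []; _∷_)
  open import Data.List.Relation.Unary.Any using (here; there)
  open import Data.List.Relation.Unary.Unique.Propositional using (Unique)
  import Data.List.Relation.Unary.Unique.Propositional.Properties as Unique
  open import Data.Nat using (ℕ; suc; _+_; _*_; _≤_; _<_; z≤n; s≤s)
  open import Data.Nat.Combinatorics using (_C_; nC1≡n; nCk+nC[k+1]≡[n+1]C[k+1])
  open import Data.Nat.ListAction using (sum)
  open import Data.Nat.Properties
    using ( +-mono-≤; +-monoʳ-≤; +-assoc; +-cancelˡ-≤; *-identityʳ; *-zeroʳ; *-distribˡ-+; *-cancelˡ-≤
          ; *-cancelˡ-<; m≤m+n; m≤n+m; ≤-refl; ≤-trans; ≤-<-trans; <⇒≱; ≮⇒≥; m≤n⇒m⊓n≡m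
          ; +-commutativeSemigroup; module ≤-Reasoning )
  open import Algebra.Properties.CommutativeSemigroup +-commutativeSemigroup using (interchange)
  open import Function using (_∘_; id; Equivalence)
  open import Relation.Binary.Definitions using (DecidableEquality)
  open import Relation.Nullary using (¬_; yes; no; contradiction)

  private
    variable
      A B : Set

  ∑ : List A → (A → ℕ) → ℕ
  ∑ []       f = 0
  ∑ (x ∷ xs) f = f x + ∑ xs f

  syntax ∑ xs (λ x → e) = ∑[ x ∈ xs ] e

  Bool→ℕ : Bool → ℕ
  Bool→ℕ true  = 1
  Bool→ℕ false = 0

  pairs : List A → List (A × A)
  pairs []       = []
  pairs (x ∷ xs) = map (x ,_) xs ++ pairs xs

  ∑-cong : ∀ xs {f g : A → ℕ} → (∀ x → f x ≡ g x) → ∑ xs f ≡ ∑ xs g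
  ∑-cong []       f≗g = refl
  ∑-cong (x ∷ xs) f≗g = cong₂ _+_ (f≗g x) (∑-cong xs f≗g)

  ∑-mono-≤ : ∀ {xs : List A} {f g : A → ℕ} → All (λ x → f x ≤ g x) xs → ∑ xs f ≤ ∑ xs g
  ∑-mono-≤ []           = z≤n
  ∑-mono-≤ (fx≤gx ∷ f≤g) = +-mono-≤ fx≤gx (∑-mono-≤ f≤g)

  ∑-≤-sum : ∀ {xs : List A} {ks} {f : A → ℕ} → Pointwise (λ x k → f x ≤ k) xs ks → ∑ xs f ≤ sum ks
  ∑-≤-sum []            = z≤n
  ∑-≤-sum (fx≤k ∷ f≤ks) = +-mono-≤ fx≤k (∑-≤-sum f≤ks)

  ∑-distrib-+ : ∀ xs (f g : A → ℕ) → ∑[ x ∈ xs ] (f x + g x) ≡ ∑ xs f + ∑ xs g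
  ∑-distrib-+ []       f g = refl
  ∑-distrib-+ (x ∷ xs) f g =
    trans (cong (f x + g x +_) (∑-distrib-+ xs f g)) (interchange (f x) (g x) (∑ xs f) (∑ xs g))

  ∑-const : ∀ (xs : List A) k → ∑[ x ∈ xs ] k ≡ length xs * k
  ∑-const []       k = refl
  ∑-const (x ∷ xs) k = cong (k +_) (∑-const xs k)

  *-distribˡ-∑ : ∀ k xs (f : A → ℕ) → k * ∑ xs f ≡ ∑[ x ∈ xs ] (k * f x)
  *-distribˡ-∑ k []       f = *-zeroʳ k
  *-distribˡ-∑ k (x ∷ xs) f = trans (*-distribˡ-+ k (f x) _) (cong (k * f x +_) (*-distribˡ-∑ k xs f))

  ∑-++ : ∀ xs ys (f : A → ℕ) → ∑ (xs ++ ys) f ≡ ∑ xs f + ∑ ys f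
  ∑-++ []       ys f = refl
  ∑-++ (x ∷ xs) ys f = trans (cong (f x +_) (∑-++ xs ys f)) (sym (+-assoc (f x) _ _))

  ∑-map : ∀ (h : A → B) xs (f : B → ℕ) → ∑ (map h xs) f ≡ ∑[ x ∈ xs ] f (h x)
  ∑-map h []       f = refl
  ∑-map h (x ∷ xs) f = cong (f (h x) +_) (∑-map h xs f)

  ∑-comm : ∀ (xs : List A) (ys : List B) (f : A → B → ℕ) →
           ∑[ x ∈ xs ] ∑[ y ∈ ys ] f x y ≡ ∑[ y ∈ ys ] ∑[ x ∈ xs ] f x y
  ∑-comm []       ys f = trans (sym (*-zeroʳ (length ys))) (sym (∑-const ys 0))
  ∑-comm (x ∷ xs) ys f = trans (cong (∑ ys (f x) +_) (∑-comm xs ys f))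
                               (sym (∑-distrib-+ ys (f x) (λ y → ∑[ x ∈ xs ] f x y)))

  length-filterᵇ : ∀ (p : A → Bool) xs → length (filterᵇ p xs) ≡ ∑[ x ∈ xs ] Bool→ℕ (p x)
  length-filterᵇ p []       = refl
  length-filterᵇ p (x ∷ xs) with p x
  ... | true  = cong suc (length-filterᵇ p xs)
  ... | false = length-filterᵇ p xs

  length-pairs : ∀ (xs : List A) → length (pairs xs) ≡ length xs C 2
  length-pairs []       = refl
  length-pairs (x ∷ xs) = begin
    length (map (x ,_) xs ++ pairs xs)         ≡⟨ length-++ (map (x ,_) xs) ⟩
    length (map (x ,_) xs) + length (pairs xs) ≡⟨ cong₂ _+_ (length-map (x ,_) xs) (length-pairs xs) ⟩
    length xs + length xs C 2                  ≡⟨ cong (_+ length xs C 2) (nC1≡n (length xs)) ⟨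
    length xs C 1 + length xs C 2              ≡⟨ nCk+nC[k+1]≡[n+1]C[k+1] (length xs) 1 ⟩
    suc (length xs) C 2                        ∎
    where open ≡-Reasoning

  pairs⁺ : ∀ {R : A → A → Set} {xs} → AllPairs R xs → All (uncurry R) (pairs xs)
  pairs⁺ []         = []
  pairs⁺ (Rx ∷ Rxs) = ++⁺ (map⁺ Rx) (pairs⁺ Rxs)

  -- Pointwise Bonferroni inequality: k ≤ 1 + (k choose 2).
  ∑-Bool→ℕ-≤-1+pairs : ∀ (p : A → Bool) xs →
    ∑[ x ∈ xs ] Bool→ℕ (p x) ≤ 1 + ∑[ e ∈ pairs xs ] Bool→ℕ (p (proj₁ e) ∧ p (proj₂ e))
  ∑-Bool→ℕ-≤-1+pairs p []       = z≤n
  ∑-Bool→ℕ-≤-1+pairs p (x ∷ xs)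
    rewrite ∑-++ (map (x ,_) xs) (pairs xs) (λ e → Bool→ℕ (p (proj₁ e) ∧ p (proj₂ e)))
          | ∑-map (x ,_) xs (λ e → Bool→ℕ (p (proj₁ e) ∧ p (proj₂ e)))
    with p x
  ... | true  = s≤s (m≤m+n _ _)
  ... | false = ≤-trans (∑-Bool→ℕ-≤-1+pairs p xs) (+-monoʳ-≤ 1 (m≤n+m _ _))

  unique-⊆⇒length-≤ : ∀ {xs ys : List A} → Unique xs → xs ⊆ ys → length xs ≤ length ys
  unique-⊆⇒length-≤ [] _ = z≤n
  unique-⊆⇒length-≤ {xs = x ∷ xs} (x≢xs ∷ uniq) xs⊆ys with ∈-∃++ (xs⊆ys (here refl))
  ... | ys₁ , ys₂ , refl = begin
    suc (length xs)           ≤⟨ s≤s (unique-⊆⇒length-≤ uniq xs⊆ys₁++ys₂) ⟩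
    suc (length (ys₁ ++ ys₂)) ≡⟨ ↭-length (shift x ys₁ ys₂) ⟨
    length (ys₁ ++ x ∷ ys₂)   ∎
    where
    open ≤-Reasoning
    xs⊆ys₁++ys₂ : xs ⊆ ys₁ ++ ys₂
    xs⊆ys₁++ys₂ y∈xs with ∈-resp-↭ (shift x ys₁ ys₂) (xs⊆ys (there y∈xs))
    ... | here y≡x   = contradiction (sym y≡x) (All.lookup x≢xs y∈xs)
    ... | there y∈ys = y∈ys

  module _ (_≟ᴬ_ : DecidableEquality A) where
    open import Data.List.Membership.DecPropositional _≟ᴬ_ using (_∈?_)

    ∃-fresh : ∀ {xs ys : List A} → Unique xs → length ys < length xs →
              ∃[ x ] (x ∈ xs × All (x ≢_) ys)
    ∃-fresh {xs} {ys} uniq ys<xs with All.all? (_∈? ys) xs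
    ... | yes xs⊆ys = contradiction (unique-⊆⇒length-≤ uniq (All.lookup xs⊆ys)) (<⇒≱ ys<xs)
    ... | no xs⊈ys with find (¬All⇒Any¬ (_∈? ys) xs xs⊈ys)
    ...   | x , x∈xs , x∉ys = x , x∈xs , ¬Any⇒All¬ ys x∉ys

  module _ {n : ℕ} (G : Graph n) where

    neighbours : Fin n → List (Fin n)
    neighbours v = filterᵇ (adj G v) (allFin n)

    commonNeighbours : Fin n → Fin n → List (Fin n)
    commonNeighbours u v = filterᵇ (λ w → adj G u w ∧ adj G v w) (allFin n)

    codegree : Fin n → Fin n → ℕ
    codegree u v = length (commonNeighbours u v)

    Adj-sym : ∀ {u v} → Adj G u v → Adj G v u
    Adj-sym {u} {v} u~v = trans (adj-sym G v u) u~v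

    Adj⇒≢ : ∀ {u v} → Adj G u v → u ≢ v
    Adj⇒≢ {u} u~u refl with trans (sym u~u) (irref G u)
    ... | ()

    ∈-neighbours⁻ : ∀ {v w} → w ∈ neighbours v → Adj G v w
    ∈-neighbours⁻ {v} w∈ = Equivalence.to T-≡ (proj₂ (∈-filter⁻ (T? ∘ adj G v) {xs = allFin n} w∈))

    ∈-commonNeighbours⁻ : ∀ {u v w} → w ∈ commonNeighbours u v → Adj G u w × Adj G v w
    ∈-commonNeighbours⁻ {u} {v} w∈
      with Equivalence.to T-∧ (proj₂ (∈-filter⁻ (λ w → T? (adj G u w ∧ adj G v w)) {xs = allFin n} w∈))
    ... | u~w , v~w = Equivalence.to T-≡ u~w , Equivalence.to T-≡ v~w

    unique-neighbours : ∀ v → Unique (neighbours v)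
    unique-neighbours v = Unique.filter⁺ (T? ∘ adj G v) (Unique.allFin⁺ n)

    unique-commonNeighbours : ∀ u v → Unique (commonNeighbours u v)
    unique-commonNeighbours u v = Unique.filter⁺ _ (Unique.allFin⁺ n)

    ∑-degree-≤ : ∀ us → ∑ us (degree G) ≤ n + ∑ (pairs us) (uncurry codegree)
    ∑-degree-≤ us = begin
      ∑ us (degree G)
        ≡⟨ ∑-cong us (λ u → length-filterᵇ (adj G u) (allFin n)) ⟩
      ∑[ u ∈ us ] ∑[ w ∈ allFin n ] Bool→ℕ (adj G u w)
        ≡⟨ ∑-comm us (allFin n) _ ⟩
      ∑[ w ∈ allFin n ] ∑[ u ∈ us ] Bool→ℕ (adj G u w)
        ≤⟨ ∑-mono-≤ (All.universal (λ w → ∑-Bool→ℕ-≤-1+pairs (λ u → adj G u w) us) (allFin n)) ⟩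
      ∑[ w ∈ allFin n ] (1 + ∑[ e ∈ pairs us ] Bool→ℕ (common e w))
        ≡⟨ ∑-distrib-+ (allFin n) (λ _ → 1) _ ⟩
      ∑[ w ∈ allFin n ] 1 + ∑[ w ∈ allFin n ] ∑[ e ∈ pairs us ] Bool→ℕ (common e w)
        ≡⟨ cong₂ _+_ (trans (∑-const (allFin n) 1) (trans (*-identityʳ _) (length-tabulate id)))
                     (∑-comm (allFin n) (pairs us) _) ⟩
      n + ∑[ e ∈ pairs us ] ∑[ w ∈ allFin n ] Bool→ℕ (common e w)
        ≡⟨ cong (n +_) (∑-cong (pairs us) (λ e → length-filterᵇ (common e) (allFin n))) ⟨
      n + ∑ (pairs us) (uncurry codegree)
        ∎
      where
      open ≤-Reasoning
      common : Fin n × Fin n → Fin n → Bool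
      common (u , v) w = adj G u w ∧ adj G v w

    module _ (c5-free : C5Free G) where

      -- A common neighbour t ∉ {p, q} of s and s' would close the 5-cycle s t s' q p.
      codegree-≤-2 : ∀ {s p q s'} → Adj G s p → Adj G p q → Adj G q s' →
                     s ≢ q → p ≢ s' → s ≢ s' → codegree s s' ≤ 2
      codegree-≤-2 {s} {p} {q} {s'} s~p p~q q~s' s≢q p≢s' s≢s' = ≮⇒≥ closes-C5
        where
        closes-C5 : ¬ 2 < codegree s s'
        closes-C5 2<codegree
          with t , t∈ , t≢p ∷ t≢q ∷ [] ← ∃-fresh _≟_ {ys = p ∷ q ∷ []} (unique-commonNeighbours s s') 2<codegree
          with s~t , s'~t ← ∈-commonNeighbours⁻ t∈
          = c5-free ( s , t , s' , q , p
                    , Adj⇒≢ s~t , s≢s' , s≢q , Adj⇒≢ s~p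
                    , ≢-sym (Adj⇒≢ s'~t) , t≢q , t≢p
                    , Adj⇒≢ (Adj-sym q~s') , ≢-sym p≢s'
                    , ≢-sym (Adj⇒≢ p~q)
                    , s~t , Adj-sym s'~t , Adj-sym q~s' , Adj-sym p~q , Adj-sym s~p )

      module _ (high-degree : ∀ v → n + 49 ≤ 6 * degree G v) where

        48<∑codegree : ∀ ws → length ws ≡ 6 → 48 < ∑ (pairs ws) (uncurry codegree)
        48<∑codegree ws |ws|≡6 = +-cancelˡ-≤ n 49 _ (begin
          n + 49                              ≤⟨ *-cancelˡ-≤ 6 6[n+49]≤6∑degree ⟩
          ∑ ws (degree G)                     ≤⟨ ∑-degree-≤ ws ⟩
          n + ∑ (pairs ws) (uncurry codegree) ∎)
          where
          open ≤-Reasoning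
          6[n+49]≤6∑degree : 6 * (n + 49) ≤ 6 * ∑ ws (degree G)
          6[n+49]≤6∑degree = begin
            6 * (n + 49)                 ≡⟨ cong (_* (n + 49)) |ws|≡6 ⟨
            length ws * (n + 49)         ≡⟨ ∑-const ws (n + 49) ⟨
            ∑[ w ∈ ws ] (n + 49)         ≤⟨ ∑-mono-≤ (All.universal high-degree ws) ⟩
            ∑[ w ∈ ws ] (6 * degree G w) ≡⟨ *-distribˡ-∑ 6 ws (degree G) ⟨
            6 * ∑ ws (degree G)          ∎

        fresh-neighbour : ∀ v ys → length ys ≤ 4 → ∃[ w ] (Adj G v w × All (w ≢_) ys)
        fresh-neighbour v ys |ys|≤4 =
          let w , w∈ , w∉ys = ∃-fresh _≟_ (unique-neighbours v) (≤-<-trans |ys|≤4 4<degree)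
          in w , ∈-neighbours⁻ w∈ , w∉ys
          where
          4<degree : 4 < degree G v
          4<degree = *-cancelˡ-< 6 4 _ (≤-trans (m≤m+n 25 24) (≤-trans (m≤n+m 49 n) (high-degree v)))

        codegree-edge-≤-5 : ∀ {u v} → Adj G u v → codegree u v ≤ 5
        codegree-edge-≤-5 {u} {v} u~v = ≮⇒≥ λ 5<codegree →
          let six = take 6 (commonNeighbours u v)
              |six|≡6 = trans (length-take 6 (commonNeighbours u v)) (m≤n⇒m⊓n≡m 5<codegree)
          in <⇒≱ (48<∑codegree six |six|≡6) (begin
            ∑ (pairs six) (uncurry codegree)
              ≤⟨ ∑-mono-≤ (pairs⁺ (pairwise-≤-2 (take⁺ 6 (All.tabulate ∈-commonNeighbours⁻))
                                                   (Unique.take⁺ 6 (unique-commonNeighbours u v)))) ⟩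
            ∑[ e ∈ pairs six ] 2
              ≡⟨ ∑-const (pairs six) 2 ⟩
            length (pairs six) * 2
              ≡⟨ cong (_* 2) (trans (length-pairs six) (cong (_C 2) |six|≡6)) ⟩
            30
              ≤⟨ m≤m+n 30 18 ⟩
            48 ∎)
          where
          open ≤-Reasoning
          pairwise-≤-2 : ∀ {ws} → All (λ w → Adj G u w × Adj G v w) ws → Unique ws →
                         AllPairs (λ w w' → codegree w w' ≤ 2) ws
          pairwise-≤-2 []                      []            = []
          pairwise-≤-2 ((u~w , v~w) ∷ common) (w≢ws ∷ uniq) =
            All.zipWith (λ ((u~w' , v~w') , w≢w') →
                           codegree-≤-2 (Adj-sym u~w) u~v v~w' (Adj⇒≢ (Adj-sym v~w)) (Adj⇒≢ u~w') w≢w')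
                        (common , w≢ws)
            ∷ pairwise-≤-2 common uniq

        spider-∑codegree-≤-48 : ∀ {x y z a b c} → x ≢ y → y ≢ z → x ≢ z →
          Adj G x y → Adj G y z → Adj G x z → Adj G x a → Adj G y b → Adj G z c →
          All (a ≢_) (y ∷ z ∷ b ∷ c ∷ []) → All (b ≢_) (x ∷ z ∷ c ∷ []) → All (c ≢_) (x ∷ y ∷ []) →
          ∑ (pairs (x ∷ y ∷ z ∷ a ∷ b ∷ c ∷ [])) (uncurry codegree) ≤ 48
        spider-∑codegree-≤-48 x≢y y≢z x≢z x~y y~z x~z x~a y~b z~c
          (a≢y ∷ a≢z ∷ a≢b ∷ a≢c ∷ []) (b≢x ∷ b≢z ∷ b≢c ∷ []) (c≢x ∷ c≢y ∷ []) = ∑-≤-sum {f = uncurry codegree}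
          ( codegree-edge-≤-5 x~y ∷ codegree-edge-≤-5 x~z ∷ codegree-edge-≤-5 x~a
          ∷ codegree-≤-2 x~z (Adj-sym y~z) y~b x≢y (≢-sym b≢z) (≢-sym b≢x)
          ∷ codegree-≤-2 x~y y~z z~c x≢z (≢-sym c≢y) (≢-sym c≢x)
          ∷ codegree-edge-≤-5 y~z
          ∷ codegree-≤-2 y~z (Adj-sym x~z) x~a (≢-sym x≢y) (≢-sym a≢z) (≢-sym a≢y)
          ∷ codegree-edge-≤-5 y~b
          ∷ codegree-≤-2 (Adj-sym x~y) x~z z~c y≢z (≢-sym c≢x) (≢-sym c≢y)
          ∷ codegree-≤-2 (Adj-sym y~z) (Adj-sym x~y) x~a (≢-sym x≢z) (≢-sym a≢y) (≢-sym a≢z)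
          ∷ codegree-≤-2 (Adj-sym x~z) x~y y~b (≢-sym y≢z) (≢-sym b≢x) (≢-sym b≢z)
          ∷ codegree-edge-≤-5 z~c
          ∷ codegree-≤-2 (Adj-sym x~a) x~y y~b a≢y (≢-sym b≢x) a≢b
          ∷ codegree-≤-2 (Adj-sym x~a) x~z z~c a≢z (≢-sym c≢x) a≢c
          ∷ codegree-≤-2 (Adj-sym y~b) y~z z~c b≢z (≢-sym c≢y) b≢c
          ∷ [] )

        triangle-free : TriangleFree G
        triangle-free (x , y , z , x≢y , y≢z , x≢z , x~y , y~z , x~z) =
          let c , z~c , c≢xy   = fresh-neighbour z (x ∷ y ∷ []) (m≤m+n 2 2)
              b , y~b , b≢xzc  = fresh-neighbour y (x ∷ z ∷ c ∷ []) (m≤m+n 3 1)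
              a , x~a , a≢yzbc = fresh-neighbour x (y ∷ z ∷ b ∷ c ∷ []) ≤-refl
          in <⇒≱ (48<∑codegree (x ∷ y ∷ z ∷ a ∷ b ∷ c ∷ []) refl)
                 (spider-∑codegree-≤-48 x≢y y≢z x≢z x~y y~z x~z x~a y~b z~c a≢yzbc b≢xzc c≢xy)

open Combinatorics using (triangle-free)

open import Data.Nat as ℕ using (ℕ; zero; suc; _≥_)
import Data.Nat.Properties as ℕ
open import Data.Nat.Coprimality using (1-coprimeTo) renaming (sym to coprime-sym)
open import Data.Integer as ℤ using (+_; -[1+_]; +<+)
import Data.Integer.Properties as ℤ
open import Data.Rational using (ℚ; mkℚ; toℚᵘ; _≤_; _<_; _+_; _*_; _/_; 0ℚ; 1ℚ; *<*)
open import Data.Rational.Properties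
  using ( normalize-coprime; toℚᵘ-injective; toℚᵘ-mono-≤; toℚᵘ-cancel-≤; toℚᵘ-homo-+; toℚᵘ-homo-*
        ; *-zeroˡ; ≤-trans; +-monoʳ-≤; *-monoˡ-≤-nonNeg; module ≤-Reasoning )
import Data.Rational.Unnormalised as ℚᵘ
import Data.Rational.Unnormalised.Properties as ℚᵘ
open import Data.Rational.Solver using (module +-*-Solver)

toℚᵘ-ℕ→ℚ : ∀ k → toℚᵘ (ℕ→ℚ k) ≡ ℚᵘ.mkℚᵘ (+ k) 0
toℚᵘ-ℕ→ℚ k = cong toℚᵘ (normalize-coprime (coprime-sym (1-coprimeTo k)))

ℕ→ℚ-cancel-≤ : ∀ {a b} → ℕ→ℚ a ≤ ℕ→ℚ b → a ℕ.≤ b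
ℕ→ℚ-cancel-≤ {a} {b} a≤b with subst₂ ℚᵘ._≤_ (toℚᵘ-ℕ→ℚ a) (toℚᵘ-ℕ→ℚ b) (toℚᵘ-mono-≤ a≤b)
... | ℚᵘ.*≤* a*1≤b*1 = ℤ.drop‿+≤+ (subst₂ ℤ._≤_ (ℤ.*-identityʳ (+ a)) (ℤ.*-identityʳ (+ b)) a*1≤b*1)

ℕ→ℚ-homo-+ : ∀ a b → ℕ→ℚ (a ℕ.+ b) ≡ ℕ→ℚ a + ℕ→ℚ b
ℕ→ℚ-homo-+ a b = toℚᵘ-injective (begin
  toℚᵘ (ℕ→ℚ (a ℕ.+ b))                         ≡⟨ toℚᵘ-ℕ→ℚ (a ℕ.+ b) ⟩
  ℚᵘ.mkℚᵘ (+ (a ℕ.+ b)) 0                        ≈⟨ ℚᵘ.*≡* sum≡ ⟩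
  ℚᵘ.mkℚᵘ (+ a) 0 ℚᵘ.+ ℚᵘ.mkℚᵘ (+ b) 0           ≡⟨ cong₂ ℚᵘ._+_ (toℚᵘ-ℕ→ℚ a) (toℚᵘ-ℕ→ℚ b) ⟨
  toℚᵘ (ℕ→ℚ a) ℚᵘ.+ toℚᵘ (ℕ→ℚ b)              ≈⟨ toℚᵘ-homo-+ (ℕ→ℚ a) (ℕ→ℚ b) ⟨
  toℚᵘ (ℕ→ℚ a + ℕ→ℚ b)                          ∎)
  where
  open ℚᵘ.≃-Reasoning
  sum≡ : + (a ℕ.+ b) ℤ.* + 1 ≡ (+ a ℤ.* + 1 ℤ.+ + b ℤ.* + 1) ℤ.* + 1
  sum≡ rewrite ℤ.*-identityʳ (+ a) | ℤ.*-identityʳ (+ b) | ℤ.*-identityʳ (+ a ℤ.+ + b) = ℤ.pos-+ a b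

ℕ→ℚ-homo-* : ∀ a b → ℕ→ℚ (a ℕ.* b) ≡ ℕ→ℚ a * ℕ→ℚ b
ℕ→ℚ-homo-* zero    b = sym (*-zeroˡ (ℕ→ℚ b))
ℕ→ℚ-homo-* (suc a) b = begin
  ℕ→ℚ (b ℕ.+ a ℕ.* b)          ≡⟨ trans (ℕ→ℚ-homo-+ b (a ℕ.* b)) (cong (_+_ (ℕ→ℚ b)) (ℕ→ℚ-homo-* a b)) ⟩
  ℕ→ℚ b + ℕ→ℚ a * ℕ→ℚ b        ≡⟨ distrib (ℕ→ℚ a) (ℕ→ℚ b) ⟩
  (1ℚ + ℕ→ℚ a) * ℕ→ℚ b          ≡⟨ cong (_* ℕ→ℚ b) (ℕ→ℚ-homo-+ 1 a) ⟨
  ℕ→ℚ (suc a) * ℕ→ℚ b          ∎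
  where
  open ≡-Reasoning
  open +-*-Solver
  distrib : ∀ x y → y + x * y ≡ (1ℚ + x) * y
  distrib = solve 2 (λ x y → y :+ x :* y := (con 1ℚ :+ x) :* y) refl

archimedean : ∀ {γ} → 0ℚ < γ → ∀ k → ∃[ n₀ ] (∀ n → n₀ ℕ.≤ n → ℕ→ℚ k ≤ γ * ℕ→ℚ n)
archimedean {mkℚ (+ zero) _ _}     (*<* (+<+ ()))
archimedean {mkℚ -[1+ _ ] _ _}     (*<* ())
archimedean {γ@(mkℚ (+ suc p) d _)} _ k = k ℕ.* suc d , λ n k[d+1]≤n →
  toℚᵘ-cancel-≤ (ℚᵘ.≤-respʳ-≃ (ℚᵘ.≃-sym (toℚᵘ-homo-* γ (ℕ→ℚ n)))
    (subst₂ (λ K N → K ℚᵘ.≤ toℚᵘ γ ℚᵘ.* N) (sym (toℚᵘ-ℕ→ℚ k)) (sym (toℚᵘ-ℕ→ℚ n))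
      (ℚᵘ.*≤* (cross-≤ n k[d+1]≤n))))
  where
  cross-≤ : ∀ n → k ℕ.* suc d ℕ.≤ n → + k ℤ.* + suc (d ℕ.* 1) ℤ.≤ (+ suc p ℤ.* + n) ℤ.* + 1
  cross-≤ n k[d+1]≤n rewrite ℤ.*-identityʳ (+ suc p ℤ.* + n) | ℕ.*-identityʳ d =
    subst₂ ℤ._≤_ (ℤ.pos-* k (suc d)) (ℤ.pos-* (suc p) n) (ℤ.+≤+ (ℕ.≤-trans k[d+1]≤n (ℕ.m≤n*m n (suc p))))

n/6+γn≤d⇒n+6k≤6d : ∀ γ n k d → ℕ→ℚ k ≤ γ * ℕ→ℚ n →
                   ℕ→ℚ n * (+ 1 / 6) + γ * ℕ→ℚ n ≤ ℕ→ℚ d → n ℕ.+ 6 ℕ.* k ℕ.≤ 6 ℕ.* d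
n/6+γn≤d⇒n+6k≤6d γ n k d k≤γn n/6+γn≤d = ℕ→ℚ-cancel-≤ (begin
  ℕ→ℚ (n ℕ.+ 6 ℕ.* k)               ≡⟨ trans (ℕ→ℚ-homo-+ n (6 ℕ.* k)) (cong (_+_ N) (ℕ→ℚ-homo-* 6 k)) ⟩
  N + ℕ→ℚ 6 * K                      ≡⟨ scale N K ⟨
  ℕ→ℚ 6 * (N * (+ 1 / 6) + K)       ≤⟨ *-monoˡ-≤-nonNeg (ℕ→ℚ 6) (≤-trans (+-monoʳ-≤ (N * (+ 1 / 6)) k≤γn) n/6+γn≤d) ⟩
  ℕ→ℚ 6 * ℕ→ℚ d                     ≡⟨ ℕ→ℚ-homo-* 6 d ⟨
  ℕ→ℚ (6 ℕ.* d)                     ∎)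
  where
  N K : ℚ
  N = ℕ→ℚ n
  K = ℕ→ℚ k
  open ≤-Reasoning
  open +-*-Solver
  scale : ∀ x y → ℕ→ℚ 6 * (x * (+ 1 / 6) + y) ≡ x + ℕ→ℚ 6 * y
  scale = solve 2 (λ x y → con (ℕ→ℚ 6) :* (x :* con (+ 1 / 6) :+ y) := x :+ con (ℕ→ℚ 6) :* y) refl

lemma7p1 : (γ : ℚ) → 0ℚ < γ →
    ∃[ n₀ ] ((n : ℕ) → n ≥ n₀ → (G : Graph n) → C5Free G →
    ((v : Fin n) → (ℕ→ℚ n * (+ 1 / 6)) + γ * ℕ→ℚ n ≤ ℕ→ℚ (degree G v)) →
    TriangleFree G)
lemma7p1 γ 0<γ =
  let n₀ , 9≤γn = archimedean 0<γ 9
  in n₀ , λ n n₀≤n G c5-free n/6+γn≤degree → triangle-free G c5-free λ v →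
       ℕ.≤-trans (ℕ.+-monoʳ-≤ n (ℕ.m≤m+n 49 5)) (n/6+γn≤d⇒n+6k≤6d γ n 9 (degree G v) (9≤γn n n₀≤n) (n/6+γn≤degree v))
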